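{- If $G$ is a finite simple connected graph with at least two vertices and $n\ge 3$, then $S_{\rm MB}(G\circ K_n)=S_{\rm MB}'(G\circ K_n)=2$.
   Context: $K_n$ is the complete graph on $n$ vertices. The lexicographic product $G\circ H$ has vertex set $V(G)\times V(H)$, with $(g,h)(g',h')$ an edge iff $gg'\in E(G)$, or $g=g'$ and $hh'\in E(H)$. A set $W\subseteq V(X)$ is a resolving set of a connected graph $X$ if for every two distinct vertices $x,y$ there is $z\in W$ with $d(x,z)\ne d(y,z)$. In the Maker-Breaker resolving game on $X$, Resolver and Spoiler alternately select unplayed vertices of $X$; Resolver wins if the vertices he selects contain a resolving set of $X$, and Spoiler wins if she selects at least one vertex of every resolving set of $X$. The R-game is the game where Resolver moves first; the S-game is where Spoiler moves first. $S_{\rm MB}(X)$ (resp. $S_{\rm MB}'(X)$) is the minimum number of moves Spoiler needs to win the R-game (resp. S-game) on $X$ when both players play optimally. -}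

module Defs where

open import Level using (Level; _⊔_) renaming (suc to lsuc; zero to lzero)
open import Data.Nat using (ℕ; zero; suc; _<_; _≤_)
open import Data.Fin using (Fin)
open import Data.Bool using (Bool; true; false)
open import Data.Product using (Σ; ∃; ∃-syntax; _×_; _,_)
open import Data.Sum using (_⊎_)
open import Data.List using (List; []; _∷_)
open import Data.List.Membership.Propositional using (_∈_; _∉_)
open import Relation.Nullary using (¬_)
open import Relation.Binary.PropositionalEquality using (_≡_; _≢_)

record Graph : Set₁ where
  field
    V : Set
    E : V → V → Set
open Graph public

record SimpleGraph : Set where
  field
    m     : ℕ
    adj   : Fin m → Fin m → Bool
    sym   : ∀ x y → adj x y ≡ adj y x
    irref : ∀ x → adj x x ≡ false
open SimpleGraph public

toGraph : SimpleGraph → Graph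
toGraph G = record { V = Fin (m G) ; E = λ x y → adj G x y ≡ true }

K : ℕ → Graph
K n = record { V = Fin n ; E = λ x y → x ≢ y }

_∘ₗ_ : Graph → Graph → Graph
G ∘ₗ H = record
  { V = V G × V H
  ; E = λ { (g , h) (g' , h') → E G g g' ⊎ (g ≡ g' × E H h h') } }

module _ (X : Graph) where
  data Walk : V X → V X → ℕ → Set where
    here : ∀ {x} → Walk x x zero
    step : ∀ {x y z k} → E X x y → Walk y z k → Walk x z (suc k)

  Connected : Set
  Connected = ∀ x y → ∃[ k ] Walk x y k

  Dist : V X → V X → ℕ → Set
  Dist x y k = Walk x y k × (∀ j → j < k → ¬ Walk x y j)

  Resolving : (V X → Set) → Set
  Resolving W = ∀ x y → x ≢ y →
    Σ (V X) λ z → W z × Σ ℕ λ a → Σ ℕ λ b → Dist x z a × Dist y z b × a ≢ b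

  ResolverWon : List (V X) → Set₁
  ResolverWon R = Σ (V X → Set) λ W → (∀ v → W v → v ∈ R) × Resolving W

  SpoilerWon : List (V X) → Set₁
  SpoilerWon S = ∀ (W : V X → Set) → Resolving W → Σ (V X) λ v → W v × v ∈ S

  Unplayed : List (V X) → List (V X) → V X → Set
  Unplayed R S v = v ∉ R × v ∉ S

  -- SWinR k R S : Resolver to move (Resolver has R, Spoiler has S);
  --   Spoiler can force a win using at most k further moves of her own.
  -- SWinS k R S : same, Spoiler to move.
  data SWinR : ℕ → List (V X) → List (V X) → Set₁
  data SWinS : ℕ → List (V X) → List (V X) → Set₁

  data SWinR where
    doneR : ∀ {k R S} → SpoilerWon S → SWinR k R S
    moveR : ∀ {k R S} → ¬ ResolverWon R →
            (∀ v → Unplayed R S v → SWinS k (v ∷ R) S) → SWinR k R S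

  data SWinS where
    doneS : ∀ {k R S} → SpoilerWon S → SWinS k R S
    moveS : ∀ {k R S} v → Unplayed R S v → SWinR k R (v ∷ S) →
            SWinS (suc k) R S

  -- S_MB(X) = k : k is the minimum number of moves Spoiler needs to win
  -- the R-game (Resolver moves first).
  IsSMB : ℕ → Set₁
  IsSMB k = SWinR k [] [] × (∀ j → SWinR j [] [] → k ≤ j)

  -- S'_MB(X) = k : same for the S-game (Spoiler moves first).
  IsSMB' : ℕ → Set₁
  IsSMB' k = SWinS k [] [] × (∀ j → SWinS j [] [] → k ≤ j)

{-# OPTIONS --safe #-}
-- Two vertices (g, a) and (g, b) of G ∘ K_n are twins: apart from each other they have the same
-- neighbours, hence the same distance to every third vertex, so every resolving set contains one of
-- them. Spoiler therefore wins as soon as she owns two vertices of one fibre {g} × K_n. In the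
-- S-game she opens any fibre; in the R-game one avoiding Resolver's first vertex (G has two
-- vertices); since n ≥ 3 a second vertex of that fibre is still free after Resolver's reply.
-- Conversely, the complement of a single vertex s always resolves (a vertex x ≠ s is at distance
-- 0 only from itself), so one move never suffices.
module Submission where

open import Defs hiding (sym)
open import Data.Nat using (ℕ; zero; suc; _≤_; _<_; z≤n; s≤s)
open import Data.Nat.Properties using (≤-refl; ≤-trans; ≤-antisym; ≤-pred; n≤1+n; ≮⇒≥; m<1+n⇒m<n∨m≡n)
open import Data.Fin using (Fin; fromℕ<; punchIn; punchOut) renaming (zero to fzero)
open import Data.Fin.Properties using (any?; punchInᵢ≢i; punchIn-injective; punchIn-punchOut)
  renaming (_≟_ to _≟ᶠ_)
open import Data.Bool using (true) renaming (_≟_ to _≟ᵇ_)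
open import Data.Product using (_×_; ∃; _,_; proj₁; proj₂; map)
open import Data.Product.Properties using (≡-dec)
open import Data.Sum using (_⊎_; inj₁; inj₂; [_,_]′)
open import Data.Empty using (⊥-elim)
open import Data.List using ([]; _∷_; [_])
open import Data.List.Relation.Unary.Any using (here; there)
open import Data.List.Relation.Unary.All using ([]; _∷_)
open import Data.List.Relation.Unary.All.Properties using (All¬⇒¬Any)
open import Data.List.Membership.Propositional using (_∉_)
open import Function using (_∘_)
open import Relation.Nullary using (¬_; Dec; yes; no)
open import Relation.Nullary.Decidable using (map′; _×-dec_; _⊎-dec_; ¬?)
open import Relation.Binary.Definitions using (DecidableEquality)
open import Relation.Binary.PropositionalEquality using (_≡_; _≢_; refl; sym; trans; cong)

∉-[_] : {A : Set} {x y : A} → x ≢ y → x ∉ [ y ]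
∉-[ x≢y ] = All¬⇒¬Any (x≢y ∷ [])

Least : (ℕ → Set) → ℕ → Set
Least P a = P a × (∀ j → j < a → ¬ P j)

module _ {P : ℕ → Set} (P? : ∀ k → Dec (P k)) where

  least-or-none-below : ∀ k → ∃ (Least P) ⊎ (∀ j → j < k → ¬ P j)
  least-or-none-below zero = inj₂ λ _ ()
  least-or-none-below (suc k) with least-or-none-below k
  ... | inj₁ found = inj₁ found
  ... | inj₂ none with P? k
  ...   | yes p = inj₁ (k , p , none)
  ...   | no ¬p = inj₂ λ j j<1+k → [ none j , (λ { refl → ¬p }) ]′ (m<1+n⇒m<n∨m≡n j<1+k)

  least : ∀ {k} → P k → ∃ (Least P)
  least {k} p with least-or-none-below (suc k)
  ... | inj₁ found = found
  ... | inj₂ none = ⊥-elim (none k ≤-refl p)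

module _ {X : Graph} where

  Walk₀⇒≡ : ∀ {x y} → Walk X x y 0 → x ≡ y
  Walk₀⇒≡ here = refl

  Dist₀⇒≡ : ∀ {x y} → Dist X x y 0 → x ≡ y
  Dist₀⇒≡ = Walk₀⇒≡ ∘ proj₁

  Dist-refl : ∀ {x} → Dist X x x 0
  Dist-refl = here , λ _ ()

  Dist-minimal : ∀ {x y a j} → Dist X x y a → Walk X x y j → a ≤ j
  Dist-minimal (_ , shorter) w = ≮⇒≥ λ j<a → shorter _ j<a w

  module _ (_≟_ : DecidableEquality (V X)) (E? : ∀ x y → Dec (E X x y))
           (∃? : ∀ {P : V X → Set} → (∀ x → Dec (P x)) → Dec (∃ P)) where

    Walk? : ∀ k x y → Dec (Walk X x y k)
    Walk? zero x y with x ≟ y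
    ... | yes refl = yes here
    ... | no x≢y = no (x≢y ∘ Walk₀⇒≡)
    Walk? (suc k) x y =
      map′ (λ (_ , e , w) → step e w) (λ { (step e w) → _ , e , w })
           (∃? λ z → E? x z ×-dec Walk? k z y)

    connected⇒Dist : Connected X → ∀ x y → ∃ (Dist X x y)
    connected⇒Dist conn x y = least (λ k → Walk? k x y) (proj₂ (conn x y))

record Twins (X : Graph) (u v : V X) : Set where
  field
    distinct  : u ≢ v
    transferˡ : ∀ {w} → w ≢ v → E X u w → E X v w
    transferʳ : ∀ {w} → w ≢ u → E X v w → E X u w
open Twins

Twins-sym : ∀ {X u v} → Twins X u v → Twins X v u
Twins-sym t = record { distinct = distinct t ∘ sym ; transferˡ = transferʳ t ; transferʳ = transferˡ t }

module _ {X : Graph} where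

  SWinR-mono : ∀ {j k R S} → j ≤ k → SWinR X j R S → SWinR X k R S
  SWinS-mono : ∀ {j k R S} → j ≤ k → SWinS X j R S → SWinS X k R S
  SWinR-mono j≤k (doneR won) = doneR won
  SWinR-mono j≤k (moveR ¬won play) = moveR ¬won λ v unplayed → SWinS-mono j≤k (play v unplayed)
  SWinS-mono j≤k (doneS won) = doneS won
  SWinS-mono (s≤s j≤k) (moveS v unplayed r) = moveS v unplayed (SWinR-mono j≤k r)

  resolving⇒¬SpoilerWon : ∀ {W S} → Resolving X W → (∀ v → W v → v ∉ S) → ¬ SpoilerWon X S
  resolving⇒¬SpoilerWon res W∩S=∅ won with won _ res
  ... | v , Wv , v∈S = W∩S=∅ v Wv v∈S

module ResolvingGame (X : Graph) (_≟_ : DecidableEquality (V X)) (dist : ∀ x y → ∃ (Dist X x y)) where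

  ≢-resolving : ∀ s → Resolving X (_≢ s)
  ≢-resolving s x y x≢y with x ≟ s
  ... | no x≢s with dist y x
  ...   | _ , dyx = x , x≢s , 0 , _ , Dist-refl , dyx , λ { refl → x≢y (sym (Dist₀⇒≡ dyx)) }
  ≢-resolving s x y x≢y | yes refl with dist x y
  ...   | _ , dxy = y , x≢y ∘ sym , _ , 0 , dxy , Dist-refl , λ { refl → x≢y (Dist₀⇒≡ dxy) }

  twin-Walk : ∀ {u v z j} → Twins X u v → Walk X u z j → z ≢ u → ∃ λ i → i ≤ j × Walk X v z i
  twin-Walk t here z≢u = ⊥-elim (z≢u refl)
  twin-Walk {v = v} t (step {y = y} e w) _ with y ≟ v
  ... | yes refl = _ , n≤1+n _ , w
  ... | no y≢v = _ , ≤-refl , step (transferˡ t y≢v e) w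

  twin-Dist-≤ : ∀ {u v z a b} → Twins X u v → Dist X u z a → Dist X v z b → z ≢ u → b ≤ a
  twin-Dist-≤ t du dv z≢u with twin-Walk t (proj₁ du) z≢u
  ... | _ , i≤a , w = ≤-trans (Dist-minimal dv w) i≤a

  resolving-meets-Twins : ∀ {W u v} → Twins X u v → Resolving X W → W u ⊎ W v
  resolving-meets-Twins {u = u} {v} t res with res u v (distinct t)
  ... | z , Wz , a , b , du , dv , a≢b with z ≟ u | z ≟ v
  ...   | yes refl | _ = inj₁ Wz
  ...   | no _ | yes refl = inj₂ Wz
  ...   | no z≢u | no z≢v =
    ⊥-elim (a≢b (≤-antisym (twin-Dist-≤ (Twins-sym t) dv du z≢v) (twin-Dist-≤ t du dv z≢u)))

  Twins⇒SpoilerWon : ∀ {u v S} → Twins X u v → SpoilerWon X (v ∷ u ∷ S)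
  Twins⇒SpoilerWon {u} {v} t W res with resolving-meets-Twins t res
  ... | inj₁ Wu = u , Wu , there (here refl)
  ... | inj₂ Wv = v , Wv , here refl

  Twins⇒¬ResolverWon : ∀ {u v R} → Twins X u v → u ∉ R → v ∉ R → ¬ ResolverWon X R
  Twins⇒¬ResolverWon {u} {v} t u∉R v∉R (W , W⊆R , res) =
    [ u∉R ∘ W⊆R u , v∉R ∘ W⊆R v ]′ (resolving-meets-Twins t res)

  Twins⇒SWinS₂ : (u : V X) → (∀ v → ∃ λ w → Twins X u w × w ≢ v) → SWinS X 2 [] []
  Twins⇒SWinS₂ u twin-avoiding = moveS u ((λ ()) , (λ ())) (moveR ¬won reply)
    where
    ¬won : ¬ ResolverWon X []
    ¬won = Twins⇒¬ResolverWon (proj₁ (proj₂ (twin-avoiding u))) (λ ()) (λ ())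
    reply : ∀ v → Unplayed X [] [ u ] v → SWinS X 1 [ v ] [ u ]
    reply v _ with twin-avoiding v
    ... | w , t , w≢v = moveS w (∉-[ w≢v ] , ∉-[ distinct t ∘ sym ]) (doneR (Twins⇒SpoilerWon t))

  -- The vertex only excludes the empty graph, in which [] is already resolving.
  Twins⇒SWinR₂ : V X →
    (∀ v₁ → ∃ λ u → u ≢ v₁ × ∀ v₂ → ∃ λ w → Twins X u w × w ≢ v₁ × w ≢ v₂) → SWinR X 2 [] []
  Twins⇒SWinR₂ x₀ strategy = moveR ¬won-[] reply₁
    where
    ¬won-[] : ¬ ResolverWon X []
    ¬won-[] with strategy x₀
    ... | u , _ , twin-avoiding = Twins⇒¬ResolverWon (proj₁ (proj₂ (twin-avoiding u))) (λ ()) (λ ())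
    reply₁ : ∀ v₁ → Unplayed X [] [] v₁ → SWinS X 2 [ v₁ ] []
    reply₁ v₁ _ with strategy v₁
    ... | u , u≢v₁ , twin-avoiding = moveS u (∉-[ u≢v₁ ] , λ ()) (moveR ¬won reply₂)
      where
      ¬won : ¬ ResolverWon X [ v₁ ]
      ¬won with twin-avoiding u
      ... | _ , t , w≢v₁ , _ = Twins⇒¬ResolverWon t ∉-[ u≢v₁ ] ∉-[ w≢v₁ ]
      reply₂ : ∀ v₂ → Unplayed X [ v₁ ] [ u ] v₂ → SWinS X 1 (v₂ ∷ v₁ ∷ []) [ u ]
      reply₂ v₂ _ with twin-avoiding v₂
      ... | w , t , w≢v₁ , w≢v₂ =
        moveS w (All¬⇒¬Any (w≢v₂ ∷ w≢v₁ ∷ []) , ∉-[ distinct t ∘ sym ]) (doneR (Twins⇒SpoilerWon t))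

  module LowerBound (x₀ : V X) (third : ∀ u v → ∃ λ (w : V X) → w ≢ u × w ≢ v) where

    ¬SpoilerWon-[] : ¬ SpoilerWon X []
    ¬SpoilerWon-[] = resolving⇒¬SpoilerWon {W = _≢ x₀} (≢-resolving x₀) λ _ _ ()

    ¬SpoilerWon-[_] : ∀ s → ¬ SpoilerWon X [ s ]
    ¬SpoilerWon-[ s ] = resolving⇒¬SpoilerWon {W = _≢ s} (≢-resolving s) λ _ → ∉-[_]

    ¬SWinR₀ : ∀ {R s} v → Unplayed X R [ s ] v → ¬ SWinR X 0 R [ s ]
    ¬SWinR₀ v _ (doneR won) = ¬SpoilerWon-[ _ ] won
    ¬SWinR₀ v unplayed (moveR _ play) with play v unplayed
    ... | doneS won = ¬SpoilerWon-[ _ ] won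

    ¬SWinS₁ : ¬ SWinS X 1 [] []
    ¬SWinS₁ (doneS won) = ¬SpoilerWon-[] won
    ¬SWinS₁ (moveS s _ r) with third s s
    ... | w , w≢s , _ = ¬SWinR₀ w ((λ ()) , ∉-[ w≢s ]) r

    ¬SWinR₁ : ¬ SWinR X 1 [] []
    ¬SWinR₁ (doneR won) = ¬SpoilerWon-[] won
    ¬SWinR₁ (moveR _ play) with play x₀ ((λ ()) , (λ ()))
    ... | doneS won = ¬SpoilerWon-[] won
    ... | moveS s _ r with third x₀ s
    ...   | w , w≢x₀ , w≢s = ¬SWinR₀ w (∉-[ w≢x₀ ] , ∉-[ w≢s ]) r

    SWinR⇒2≤ : ∀ j → SWinR X j [] [] → 2 ≤ j
    SWinR⇒2≤ j r = ≮⇒≥ λ j<2 → ¬SWinR₁ (SWinR-mono (≤-pred j<2) r)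

    SWinS⇒2≤ : ∀ j → SWinS X j [] [] → 2 ≤ j
    SWinS⇒2≤ j s = ≮⇒≥ λ j<2 → ¬SWinS₁ (SWinS-mono (≤-pred j<2) s)

Fin-other : ∀ {m} → 2 ≤ m → (i : Fin m) → ∃ λ j → j ≢ i
Fin-other (s≤s (s≤s _)) i = punchIn i fzero , punchInᵢ≢i i fzero

Fin-third : ∀ {n} → 3 ≤ n → (a b : Fin n) → ∃ λ c → c ≢ a × c ≢ b
Fin-third (s≤s (s≤s (s≤s _))) a b with a ≟ᶠ b
... | yes refl = punchIn a fzero , punchInᵢ≢i a fzero , punchInᵢ≢i a fzero
... | no a≢b = punchIn a c , punchInᵢ≢i a c , c≢b
  where
  b′ = punchOut a≢b
  c = punchIn b′ fzero
  c≢b : punchIn a c ≢ b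
  c≢b eq = punchInᵢ≢i b′ fzero (punchIn-injective a c b′ (trans eq (sym (punchIn-punchOut a≢b))))

module _ {G : Graph} {n : ℕ} where

  ∘K-transfer : ∀ {g a b w} → w ≢ (g , b) → E (G ∘ₗ K n) (g , a) w → E (G ∘ₗ K n) (g , b) w
  ∘K-transfer _ (inj₁ e) = inj₁ e
  ∘K-transfer w≢gb (inj₂ (refl , _)) = inj₂ (refl , λ { refl → w≢gb refl })

  ∘K-Twins : ∀ {g a b} → a ≢ b → Twins (G ∘ₗ K n) (g , a) (g , b)
  ∘K-Twins a≢b = record { distinct = a≢b ∘ cong proj₂ ; transferˡ = ∘K-transfer ; transferʳ = ∘K-transfer }

  ∘K-connected : Connected G → Connected (G ∘ₗ K n)
  ∘K-connected conn (g , h) (g′ , h′) = lift (proj₂ (conn g g′))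
    where
    lift : ∀ {g j} → Walk G g g′ j → ∃ (Walk (G ∘ₗ K n) (g , h) (g′ , h′))
    lift here with h ≟ᶠ h′
    ... | yes refl = 0 , here
    ... | no h≢h′ = 1 , step (inj₂ (refl , h≢h′)) here
    lift (step e w) = map suc (step (inj₁ e)) (lift w)

  module _ (3≤n : 3 ≤ n) where

    ∘K-third : ∀ u v → ∃ λ (w : V (G ∘ₗ K n)) → w ≢ u × w ≢ v
    ∘K-third (g , a) (_ , b) with Fin-third 3≤n a b
    ... | c , c≢a , c≢b = (g , c) , c≢a ∘ cong proj₂ , c≢b ∘ cong proj₂

    ∘K-twin-avoiding : ∀ g a (v : V (G ∘ₗ K n)) → ∃ λ c → Twins (G ∘ₗ K n) (g , a) (g , c) × (g , c) ≢ v
    ∘K-twin-avoiding g a (_ , b) with Fin-third 3≤n a b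
    ... | c , c≢a , c≢b = c , ∘K-Twins (c≢a ∘ sym) , c≢b ∘ cong proj₂

    ∘K-fresh-fibre : (∀ g → ∃ λ g′ → g′ ≢ g) → ∀ v₁ →
      ∃ λ u → u ≢ v₁ × ∀ v₂ → ∃ λ w → Twins (G ∘ₗ K n) u w × w ≢ v₁ × w ≢ v₂
    ∘K-fresh-fibre other (g₁ , a) with other g₁
    ... | g , g≢g₁ = (g , a) , g≢g₁ ∘ cong proj₁ , λ v₂ →
      let c , t , gc≢v₂ = ∘K-twin-avoiding g a v₂ in (g , c) , t , g≢g₁ ∘ cong proj₁ , gc≢v₂

module _ (G : SimpleGraph) (n : ℕ) where

  ∘K-≟ : DecidableEquality (Fin (m G) × Fin n)
  ∘K-≟ = ≡-dec _≟ᶠ_ _≟ᶠ_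

  ∘K-Dist : Connected (toGraph G) → ∀ x y → ∃ (Dist (toGraph G ∘ₗ K n) x y)
  ∘K-Dist conn = connected⇒Dist {X = toGraph G ∘ₗ K n} ∘K-≟ E? ∃? (∘K-connected conn)
    where
    E? : ∀ x y → Dec (E (toGraph G ∘ₗ K n) x y)
    E? (g , h) (g′ , h′) = (adj G g g′ ≟ᵇ true) ⊎-dec ((g ≟ᶠ g′) ×-dec ¬? (h ≟ᶠ h′))
    ∃? : ∀ {P : Fin (m G) × Fin n → Set} → (∀ x → Dec (P x)) → Dec (∃ P)
    ∃? P? = map′ (λ (g , h , p) → (g , h) , p) (λ ((g , h) , p) → g , h , p)
                 (any? λ g → any? λ h → P? (g , h))

proposition4p1 : (G : SimpleGraph) → Connected (toGraph G) → 2 ≤ m G →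
    (n : ℕ) → 3 ≤ n →
    IsSMB (toGraph G ∘ₗ K n) 2 × IsSMB' (toGraph G ∘ₗ K n) 2
proposition4p1 G conn 2≤m n 3≤n =
    (Twins⇒SWinR₂ x₀ (∘K-fresh-fibre 3≤n (Fin-other 2≤m)) , SWinR⇒2≤)
  , (Twins⇒SWinS₂ x₀ (λ v → _ , proj₂ (∘K-twin-avoiding 3≤n g₀ a₀ v)) , SWinS⇒2≤)
  where
  g₀ : Fin (m G)
  g₀ = fromℕ< (≤-trans (s≤s z≤n) 2≤m)
  a₀ : Fin n
  a₀ = fromℕ< (≤-trans (s≤s z≤n) 3≤n)
  x₀ : Fin (m G) × Fin n
  x₀ = g₀ , a₀
  open ResolvingGame (toGraph G ∘ₗ K n) (∘K-≟ G n) (∘K-Dist G n conn)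
  open LowerBound x₀ (∘K-third {G = toGraph G} 3≤n)
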